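{- Let $g(z)=\sum_{n\ge1}g_nz^n$ and $f(z)=\sum_{n\ge0}f_nz^n$ be formal power series. Then, as formal power series, \[ f'\!\left(\frac{z}{1-z}\right) g(z)=\sum_{n\ge1} z^n\sum_{\pi\in\mathcal{C}(n)} f_{|\pi|}\sum_{i=1}^{|\pi|} g_{k_i}, \] where for $\pi=(k_1,\dots,k_m)$ the inner sum $\sum_{i=1}^{m}g_{k_i}$ runs over all parts of $\pi$ (counted with multiplicity).
   Context: A composition of $n\ge1$ is a sequence $\pi=(k_1,\dots,k_m)$ of integers $k_i\ge1$ with $k_1+\dots+k_m=n$; $\mathcal{C}(n)$ is the set of compositions of $n$ and $|\pi|=m$ its number of parts. $f'$ denotes the formal derivative of $f$. -}

module Defs where

open import Level using (Level)
open import Data.Nat using (ℕ; zero; suc; _∸_)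
open import Data.List using (List; []; _∷_; [_]; map; concatMap; upTo; foldr)
open import Algebra.Bundles using (CommutativeRing)

-- Compositions of n: lists (k₁,…,k_m) of positive integers summing to n.
-- compsF fuel n enumerates them by choosing the first part k ∈ {1,…,n}
-- and recursing on n ∸ k; fuel n is always enough since parts are ≥ 1.
compsF : ℕ → ℕ → List (List ℕ)
compsF _        zero    = [ [] ]
compsF zero     (suc n) = []
compsF (suc fu) (suc n) =
  concatMap (λ k → map (suc k ∷_) (compsF fu (suc n ∸ suc k))) (upTo (suc n))

compositions : ℕ → List (List ℕ)
compositions n = compsF n n

nparts : List ℕ → ℕ
nparts = Data.List.length

module FPS {c ℓ : Level} (R : CommutativeRing c ℓ) where
  open CommutativeRing R

  Series : Set c
  Series = ℕ → Carrier

  Σ[_]_ : {A : Set} → List A → (A → Carrier) → Carrier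
  Σ[ xs ] h = foldr (λ x acc → h x + acc) 0# xs

  Σ≤ : ℕ → (ℕ → Carrier) → Carrier
  Σ≤ n h = Σ[ upTo (suc n) ] h

  fromℕ : ℕ → Carrier
  fromℕ zero    = 0#
  fromℕ (suc k) = 1# + fromℕ k

  oneS : Series
  oneS zero    = 1#
  oneS (suc _) = 0#

  _⊛_ : Series → Series → Series
  (a ⊛ b) n = Σ≤ n (λ i → a i * b (n ∸ i))

  _^S_ : Series → ℕ → Series
  u ^S zero  = oneS
  u ^S suc m = u ⊛ (u ^S m)

  -- composition h(u(z)), for u with zero constant term:
  -- [zⁿ] h(u) = Σ_{m=0}^{n} h_m [zⁿ] u^m
  _∘S_ : Series → Series → Series
  (h ∘S u) n = Σ≤ n (λ m → h m * (u ^S m) n)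

  deriv : Series → Series
  deriv f n = fromℕ (suc n) * f (suc n)

  z/1-z : Series
  z/1-z zero    = 0#
  z/1-z (suc _) = 1#

  lhs : Series → Series → Series
  lhs f g = (deriv f ∘S z/1-z) ⊛ g

  rhs : Series → Series → Series
  rhs f g zero    = 0#
  rhs f g (suc n) =
    Σ[ compositions (suc n) ] (λ π → f (nparts π) * Σ[ π ] g)

-- Write 𝒮 h for the series with coefficients Σ_{π ∈ 𝒞(n)} h_{|π|}, and h⁺ for the
-- shifted sequence h⁺_m = h_{m+1}. Splitting off the first part of a composition
-- gives 𝒮 h = h₀ + z/(1-z) · 𝒮 h⁺; splitting off one factor of (z/(1-z))^m shows
-- that h(z/(1-z)) satisfies the same recurrence, so h(z/(1-z)) = 𝒮 h. The first
-- part of a composition is either the marked part or not, so the right-hand side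
-- 𝒯 f satisfies 𝒯 f = g · 𝒮 f⁺ + z/(1-z) · 𝒯 f⁺ (using g₀ = 0). Since
-- (f')⁺ = (f⁺)' + f⁺⁺, also 𝒮 f' = 𝒮 f⁺ + z/(1-z) · 𝒮 (f⁺)', so 𝒮 f' · g obeys
-- the recurrence of 𝒯 f, and 𝒯 f = 𝒮 f' · g by induction on the degree.
-- Coefficientwise, [z^{n+1}] (z/(1-z) · a) is (ones ⊛ a) n below.
module Submission where

open import Defs
open import Level using (Level)
open import Data.Nat as ℕ using (ℕ; zero; suc; _∸_; _≤_; _<_; z≤n; s≤s)
open import Data.Nat.Properties
  using (≤-pred; ≤-trans; ≤-refl; ≤-<-trans; m≤m+n; m∸n≤m; m+[n∸m]≡n; m∸[m∸n]≡n; n∸n≡0; +-∸-assoc)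
open import Data.Nat.Induction using (<-rec)
open import Data.List using (List; []; _∷_; _++_; map; concat; applyUpTo)
open import Algebra.Bundles using (CommutativeRing)
import Algebra.Properties.CommutativeSemigroup as CommutativeSemigroupProperties
open import Relation.Binary.PropositionalEquality as ≡ using (_≡_)

module _ {c ℓ : Level} (R : CommutativeRing c ℓ) where
  open CommutativeRing R
  open FPS R
  open CommutativeSemigroupProperties +-commutativeSemigroup using ()
    renaming (interchange to +-interchange)
  open CommutativeSemigroupProperties *-commutativeSemigroup using ()
    renaming (x∙yz≈y∙xz to x*yz≈y*xz)
  open import Relation.Binary.Reasoning.Setoid setoid

  Σ-cong : {A : Set} (xs : List A) {h h′ : A → Carrier} →
           (∀ x → h x ≈ h′ x) → Σ[ xs ] h ≈ Σ[ xs ] h′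
  Σ-cong []       h≈h′ = refl
  Σ-cong (x ∷ xs) h≈h′ = +-cong (h≈h′ x) (Σ-cong xs h≈h′)

  Σ-++ : {A : Set} (xs ys : List A) (h : A → Carrier) →
         Σ[ xs ++ ys ] h ≈ Σ[ xs ] h + Σ[ ys ] h
  Σ-++ []       ys h = sym (+-identityˡ _)
  Σ-++ (x ∷ xs) ys h = trans (+-congˡ (Σ-++ xs ys h)) (sym (+-assoc _ _ _))

  Σ-concat : {A : Set} (xss : List (List A)) (h : A → Carrier) →
             Σ[ concat xss ] h ≈ Σ[ xss ] (λ xs → Σ[ xs ] h)
  Σ-concat []         h = refl
  Σ-concat (xs ∷ xss) h = trans (Σ-++ xs (concat xss) h) (+-congˡ (Σ-concat xss h))

  Σ-map : {A B : Set} (f : A → B) (xs : List A) (h : B → Carrier) →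
          Σ[ map f xs ] h ≡ Σ[ xs ] (λ x → h (f x))
  Σ-map f []       h = ≡.refl
  Σ-map f (x ∷ xs) h = ≡.cong (h (f x) +_) (Σ-map f xs h)

  Σ-+ : {A : Set} (xs : List A) (h h′ : A → Carrier) →
        Σ[ xs ] (λ x → h x + h′ x) ≈ Σ[ xs ] h + Σ[ xs ] h′
  Σ-+ []       h h′ = sym (+-identityʳ _)
  Σ-+ (x ∷ xs) h h′ = trans (+-congˡ (Σ-+ xs h h′)) (+-interchange _ _ _ _)

  *-distribˡ-Σ : {A : Set} (xs : List A) (a : Carrier) (h : A → Carrier) →
                 a * Σ[ xs ] h ≈ Σ[ xs ] (λ x → a * h x)
  *-distribˡ-Σ []       a h = zeroʳ a
  *-distribˡ-Σ (x ∷ xs) a h = trans (distribˡ a _ _) (+-congˡ (*-distribˡ-Σ xs a h))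

  -- Opaque so that Σ< (suc n) h does not unfold, letting unification recover h.
  opaque
    Σ< : ℕ → (ℕ → Carrier) → Carrier
    Σ< zero    h = 0#
    Σ< (suc n) h = h 0 + Σ< n (λ i → h (suc i))

    Σ<-suc : ∀ n (h : ℕ → Carrier) → Σ< (suc n) h ≡ h 0 + Σ< n (λ i → h (suc i))
    Σ<-suc n h = ≡.refl

    Σ-applyUpTo : ∀ n (f : ℕ → ℕ) (h : ℕ → Carrier) →
                  Σ[ applyUpTo f n ] h ≡ Σ< n (λ i → h (f i))
    Σ-applyUpTo zero    f h = ≡.refl
    Σ-applyUpTo (suc n) f h = ≡.cong (h (f 0) +_) (Σ-applyUpTo n (λ i → f (suc i)) h)

    Σ≤≡Σ< : ∀ n (h : ℕ → Carrier) → Σ≤ n h ≡ Σ< (suc n) h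
    Σ≤≡Σ< n = Σ-applyUpTo (suc n) (λ i → i)

    Σ<-cong : ∀ n {h h′ : ℕ → Carrier} → (∀ i → i < n → h i ≈ h′ i) → Σ< n h ≈ Σ< n h′
    Σ<-cong zero    h≈h′ = refl
    Σ<-cong (suc n) h≈h′ = +-cong (h≈h′ 0 (s≤s z≤n)) (Σ<-cong n (λ i i<n → h≈h′ (suc i) (s≤s i<n)))

    Σ<-+ : ∀ n (h h′ : ℕ → Carrier) → Σ< n (λ i → h i + h′ i) ≈ Σ< n h + Σ< n h′
    Σ<-+ zero    h h′ = sym (+-identityʳ _)
    Σ<-+ (suc n) h h′ = trans (+-congˡ (Σ<-+ n _ _)) (+-interchange _ _ _ _)

    *-distribˡ-Σ< : ∀ n a (h : ℕ → Carrier) → a * Σ< n h ≈ Σ< n (λ i → a * h i)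
    *-distribˡ-Σ< zero    a h = zeroʳ a
    *-distribˡ-Σ< (suc n) a h = trans (distribˡ a _ _) (+-congˡ (*-distribˡ-Σ< n a _))

    Σ<-zero : ∀ n (h : ℕ → Carrier) → (∀ i → i < n → h i ≈ 0#) → Σ< n h ≈ 0#
    Σ<-zero zero    h h≈0 = refl
    Σ<-zero (suc n) h h≈0 =
      trans (+-cong (h≈0 0 (s≤s z≤n)) (Σ<-zero n _ (λ i i<n → h≈0 (suc i) (s≤s i<n))))
            (+-identityʳ 0#)

    Σ<-split : ∀ m d (h : ℕ → Carrier) → Σ< (m ℕ.+ d) h ≈ Σ< m h + Σ< d (λ i → h (m ℕ.+ i))
    Σ<-split zero    d h = sym (+-identityˡ _)
    Σ<-split (suc m) d h = trans (+-congˡ (Σ<-split m d _)) (sym (+-assoc _ _ _))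

    Σ<-truncate : ∀ {m N} (h : ℕ → Carrier) → m ≤ N → (∀ i → m ≤ i → h i ≈ 0#) →
                  Σ< N h ≈ Σ< m h
    Σ<-truncate {m} {N} h m≤N tail≈0 =
      ≡.subst (λ M → Σ< M h ≈ Σ< m h) (m+[n∸m]≡n m≤N) drop-tail
      where
      drop-tail : Σ< (m ℕ.+ (N ∸ m)) h ≈ Σ< m h
      drop-tail = trans (Σ<-split m (N ∸ m) h)
        (trans (+-congˡ (Σ<-zero (N ∸ m) _ (λ i _ → tail≈0 (m ℕ.+ i) (m≤m+n m i))))
               (+-identityʳ _))

    Σ<-last : ∀ n (h : ℕ → Carrier) → Σ< (suc n) h ≈ Σ< n h + h n
    Σ<-last zero    h = +-comm _ _
    Σ<-last (suc n) h = trans (+-congˡ (Σ<-last n _)) (sym (+-assoc _ _ _))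

    Σ<-reverse : ∀ n (h : ℕ → Carrier) → Σ< n h ≈ Σ< n (λ i → h (n ∸ suc i))
    Σ<-reverse zero    h = refl
    Σ<-reverse (suc n) h = begin
      h 0 + Σ< n (λ i → h (suc i))                ≈⟨ +-congˡ (Σ<-reverse n _) ⟩
      h 0 + Σ< n (λ i → h (suc (n ∸ suc i)))      ≈⟨ +-comm _ _ ⟩
      Σ< n (λ i → h (suc (n ∸ suc i))) + h 0      ≈⟨ +-cong (Σ<-cong n (λ i i<n →
                                                       reflexive (≡.cong h (≡.sym (+-∸-assoc 1 i<n)))))
                                                     (reflexive (≡.cong h (≡.sym (n∸n≡0 n)))) ⟩
      Σ< n (λ i → h (n ∸ i)) + h (n ∸ n)          ≈⟨ Σ<-last n _ ⟨
      Σ< (suc n) (λ i → h (n ∸ i))                ∎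

    Σ<-swap : ∀ a b (F : ℕ → ℕ → Carrier) →
              Σ< a (λ m → Σ< b (F m)) ≈ Σ< b (λ k → Σ< a (λ m → F m k))
    Σ<-swap zero    b F = sym (Σ<-zero b _ (λ _ _ → refl))
    Σ<-swap (suc a) b F = trans (+-congˡ (Σ<-swap a b _)) (sym (Σ<-+ b _ _))

  shift : Series → Series
  shift a n = a (suc n)

  ones : Series
  ones _ = 1#

  ⊛-as-Σ< : ∀ (a b : Series) n → (a ⊛ b) n ≡ Σ< (suc n) (λ i → a i * b (n ∸ i))
  ⊛-as-Σ< a b n = Σ≤≡Σ< n _

  ⊛-sucˡ : ∀ (a b : Series) n → (a ⊛ b) (suc n) ≡ a 0 * b (suc n) + (shift a ⊛ b) n
  ⊛-sucˡ a b n = ≡.trans (⊛-as-Σ< a b (suc n)) (≡.trans (Σ<-suc (suc n) _)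
                         (≡.cong (a 0 * b (suc n) +_) (≡.sym (⊛-as-Σ< (shift a) b n))))

  ⊛-cong : ∀ {a a′ b b′ : Series} n → (∀ i → i ≤ n → a i ≈ a′ i) → (∀ i → i ≤ n → b i ≈ b′ i) →
           (a ⊛ b) n ≈ (a′ ⊛ b′) n
  ⊛-cong {a} {a′} {b} {b′} n a≈a′ b≈b′ = begin
    (a ⊛ b) n                                ≡⟨ ⊛-as-Σ< a b n ⟩
    Σ< (suc n) (λ i → a i * b (n ∸ i))       ≈⟨ Σ<-cong (suc n) (λ i i≤n →
                                                  *-cong (a≈a′ i (≤-pred i≤n)) (b≈b′ (n ∸ i) (m∸n≤m n i))) ⟩
    Σ< (suc n) (λ i → a′ i * b′ (n ∸ i))     ≡⟨ ⊛-as-Σ< a′ b′ n ⟨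
    (a′ ⊛ b′) n                              ∎

  ⊛-comm : ∀ (a b : Series) n → (a ⊛ b) n ≈ (b ⊛ a) n
  ⊛-comm a b n = begin
    (a ⊛ b) n                                        ≡⟨ ⊛-as-Σ< a b n ⟩
    Σ< (suc n) (λ i → a i * b (n ∸ i))               ≈⟨ Σ<-reverse (suc n) _ ⟩
    Σ< (suc n) (λ i → a (n ∸ i) * b (n ∸ (n ∸ i)))   ≈⟨ Σ<-cong (suc n) (λ i i≤n →
                                                         trans (*-comm _ _)
                                                               (*-congʳ (reflexive (≡.cong b (m∸[m∸n]≡n (≤-pred i≤n)))))) ⟩
    Σ< (suc n) (λ i → b i * a (n ∸ i))               ≡⟨ ⊛-as-Σ< b a n ⟨
    (b ⊛ a) n                                        ∎

  ⊛-distribʳ : ∀ (a a′ b : Series) n → ((λ i → a i + a′ i) ⊛ b) n ≈ (a ⊛ b) n + (a′ ⊛ b) n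
  ⊛-distribʳ a a′ b n = begin
    ((λ i → a i + a′ i) ⊛ b) n                                        ≡⟨ ⊛-as-Σ< _ b n ⟩
    Σ< (suc n) (λ i → (a i + a′ i) * b (n ∸ i))                       ≈⟨ Σ<-cong (suc n) (λ i _ → distribʳ _ _ _) ⟩
    Σ< (suc n) (λ i → a i * b (n ∸ i) + a′ i * b (n ∸ i))             ≈⟨ Σ<-+ (suc n) _ _ ⟩
    Σ< (suc n) (λ i → a i * b (n ∸ i)) + Σ< (suc n) (λ i → a′ i * b (n ∸ i))
                                                                      ≡⟨ ≡.cong₂ _+_ (⊛-as-Σ< a b n) (⊛-as-Σ< a′ b n) ⟨
    (a ⊛ b) n + (a′ ⊛ b) n                                            ∎

  ⊛-distribˡ : ∀ (a b b′ : Series) n → (a ⊛ (λ i → b i + b′ i)) n ≈ (a ⊛ b) n + (a ⊛ b′) n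
  ⊛-distribˡ a b b′ n =
    trans (⊛-comm a _ n) (trans (⊛-distribʳ b b′ a n) (+-cong (⊛-comm b a n) (⊛-comm b′ a n)))

  ⊛-scalarˡ : ∀ x (a b : Series) n → ((λ i → x * a i) ⊛ b) n ≈ x * (a ⊛ b) n
  ⊛-scalarˡ x a b n = begin
    ((λ i → x * a i) ⊛ b) n                  ≡⟨ ⊛-as-Σ< _ b n ⟩
    Σ< (suc n) (λ i → x * a i * b (n ∸ i))   ≈⟨ Σ<-cong (suc n) (λ i _ → *-assoc _ _ _) ⟩
    Σ< (suc n) (λ i → x * (a i * b (n ∸ i))) ≈⟨ *-distribˡ-Σ< (suc n) x _ ⟨
    x * Σ< (suc n) (λ i → a i * b (n ∸ i))   ≡⟨ ≡.cong (x *_) (⊛-as-Σ< a b n) ⟨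
    x * (a ⊛ b) n                            ∎

  ⊛-assoc : ∀ (a b d : Series) n → (a ⊛ (b ⊛ d)) n ≈ ((a ⊛ b) ⊛ d) n
  ⊛-assoc a b d zero =
    +-congʳ (trans (*-congˡ (+-identityʳ _))
            (trans (sym (*-assoc _ _ _)) (*-congʳ (sym (+-identityʳ _)))))
  ⊛-assoc a b d (suc n) = begin
    (a ⊛ (b ⊛ d)) (suc n)
      ≡⟨ ≡.trans (⊛-sucˡ a (b ⊛ d) n) (≡.cong (λ x → a 0 * x + (shift a ⊛ (b ⊛ d)) n) (⊛-sucˡ b d n)) ⟩
    a 0 * (b 0 * d (suc n) + (shift b ⊛ d) n) + (shift a ⊛ (b ⊛ d)) n
      ≈⟨ +-cong (distribˡ _ _ _) (⊛-assoc (shift a) b d n) ⟩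
    (a 0 * (b 0 * d (suc n)) + a 0 * (shift b ⊛ d) n) + ((shift a ⊛ b) ⊛ d) n
      ≈⟨ +-assoc _ _ _ ⟩
    a 0 * (b 0 * d (suc n)) + (a 0 * (shift b ⊛ d) n + ((shift a ⊛ b) ⊛ d) n)
      ≈⟨ +-cong (trans (sym (*-assoc _ _ _)) (*-congʳ (sym (+-identityʳ _))))
                (+-congʳ (sym (⊛-scalarˡ (a 0) (shift b) d n))) ⟩
    (a ⊛ b) 0 * d (suc n) + (((λ j → a 0 * b (suc j)) ⊛ d) n + ((shift a ⊛ b) ⊛ d) n)
      ≈⟨ +-congˡ (sym (⊛-distribʳ _ _ d n)) ⟩
    (a ⊛ b) 0 * d (suc n) + ((λ j → a 0 * b (suc j) + (shift a ⊛ b) j) ⊛ d) n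
      ≈⟨ +-congˡ (⊛-cong {b = d} n (λ j _ → reflexive (≡.sym (⊛-sucˡ a b j))) (λ _ _ → refl)) ⟩
    (a ⊛ b) 0 * d (suc n) + (shift (a ⊛ b) ⊛ d) n
      ≡⟨ ⊛-sucˡ (a ⊛ b) d n ⟨
    ((a ⊛ b) ⊛ d) (suc n) ∎

  ⊛-shiftˡ : ∀ (a b : Series) n → a 0 ≈ 0# → (shift a ⊛ b) n ≈ (a ⊛ b) (suc n)
  ⊛-shiftˡ a b n a₀≈0 = begin
    (shift a ⊛ b) n                          ≈⟨ +-identityˡ _ ⟨
    0# + (shift a ⊛ b) n                     ≈⟨ +-congʳ (trans (*-congʳ a₀≈0) (zeroˡ _)) ⟨
    a 0 * b (suc n) + (shift a ⊛ b) n        ≡⟨ ⊛-sucˡ a b n ⟨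
    (a ⊛ b) (suc n)                          ∎

  ⊛-split-suc : ∀ (a b d g : Series) n → a 0 ≈ b 0 → (∀ j → j ≤ n → a (suc j) ≈ b (suc j) + d j) →
                (a ⊛ g) (suc n) ≈ (b ⊛ g) (suc n) + (d ⊛ g) n
  ⊛-split-suc a b d g n a₀≈b₀ a⁺≈b⁺+d = begin
    (a ⊛ g) (suc n)                                        ≡⟨ ⊛-sucˡ a g n ⟩
    a 0 * g (suc n) + (shift a ⊛ g) n                      ≈⟨ +-cong (*-congʳ a₀≈b₀) (⊛-cong {b = g} n a⁺≈b⁺+d (λ _ _ → refl)) ⟩
    b 0 * g (suc n) + ((λ j → b (suc j) + d j) ⊛ g) n      ≈⟨ +-congˡ (⊛-distribʳ (shift b) d g n) ⟩
    b 0 * g (suc n) + ((shift b ⊛ g) n + (d ⊛ g) n)        ≈⟨ +-assoc _ _ _ ⟨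
    (b 0 * g (suc n) + (shift b ⊛ g) n) + (d ⊛ g) n        ≡⟨ ≡.cong (_+ (d ⊛ g) n) (⊛-sucˡ b g n) ⟨
    (b ⊛ g) (suc n) + (d ⊛ g) n                            ∎

  ^S-vanishes : ∀ {u : Series} → u 0 ≈ 0# → ∀ m n → n < m → (u ^S m) n ≈ 0#
  ^S-vanishes {u} u₀≈0 (suc m) n n<m =
    trans (reflexive (⊛-as-Σ< u (u ^S m) n)) (Σ<-zero (suc n) _ (term≈0 n n<m))
    where
    term≈0 : ∀ n → n < suc m → ∀ i → i < suc n → u i * (u ^S m) (n ∸ i) ≈ 0#
    term≈0 n       _         zero    _            = trans (*-congʳ u₀≈0) (zeroˡ _)
    term≈0 zero    _         (suc i) (s≤s ())
    term≈0 (suc n) (s≤s n<m) (suc i) _            =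
      trans (*-congˡ (^S-vanishes u₀≈0 m (n ∸ i) (≤-<-trans (m∸n≤m n i) n<m))) (zeroʳ _)

  -- h(u) = h₀ + u · h⁺(u), read off at degree n + 1 with u = z · shift u.
  ∘S-suc : ∀ {u : Series} → u 0 ≈ 0# → ∀ (h : Series) n →
           (h ∘S u) (suc n) ≈ (shift u ⊛ (shift h ∘S u)) n
  ∘S-suc {u} u₀≈0 h n = begin
    (h ∘S u) (suc n)
      ≡⟨ ≡.trans (Σ≤≡Σ< (suc n) _) (Σ<-suc (suc n) _) ⟩
    h 0 * 0# + Σ< (suc n) (λ m → h (suc m) * (u ⊛ (u ^S m)) (suc n))
      ≈⟨ trans (+-congʳ (zeroʳ _)) (+-identityˡ _) ⟩
    Σ< (suc n) (λ m → h (suc m) * (u ⊛ (u ^S m)) (suc n))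
      ≈⟨ Σ<-cong (suc n) (λ m _ → *-congˡ (first-factor m)) ⟩
    Σ< (suc n) (λ m → h (suc m) * Σ< (suc n) (λ k → u (suc k) * (u ^S m) (n ∸ k)))
      ≈⟨ Σ<-cong (suc n) (λ m _ → *-distribˡ-Σ< (suc n) _ _) ⟩
    Σ< (suc n) (λ m → Σ< (suc n) (λ k → h (suc m) * (u (suc k) * (u ^S m) (n ∸ k))))
      ≈⟨ Σ<-swap (suc n) (suc n) _ ⟩
    Σ< (suc n) (λ k → Σ< (suc n) (λ m → h (suc m) * (u (suc k) * (u ^S m) (n ∸ k))))
      ≈⟨ Σ<-cong (suc n) (λ k _ → trans (Σ<-cong (suc n) (λ m _ → x*yz≈y*xz _ _ _))
                                        (sym (*-distribˡ-Σ< (suc n) _ _))) ⟩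
    Σ< (suc n) (λ k → u (suc k) * Σ< (suc n) (λ m → h (suc m) * (u ^S m) (n ∸ k)))
      ≈⟨ Σ<-cong (suc n) (λ k _ → *-congˡ (truncate (n ∸ k) (s≤s (m∸n≤m n k)))) ⟩
    Σ< (suc n) (λ k → u (suc k) * (shift h ∘S u) (n ∸ k))
      ≡⟨ ⊛-as-Σ< (shift u) (shift h ∘S u) n ⟨
    (shift u ⊛ (shift h ∘S u)) n ∎
    where
    first-factor : ∀ m → (u ⊛ (u ^S m)) (suc n) ≈ Σ< (suc n) (λ k → u (suc k) * (u ^S m) (n ∸ k))
    first-factor m = trans (reflexive (⊛-sucˡ u (u ^S m) n))
      (trans (+-congʳ (trans (*-congʳ u₀≈0) (zeroˡ _)))
      (trans (+-identityˡ _) (reflexive (⊛-as-Σ< (shift u) (u ^S m) n))))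
    truncate : ∀ j → suc j ≤ suc n → Σ< (suc n) (λ m → h (suc m) * (u ^S m) j) ≈ (shift h ∘S u) j
    truncate j j≤n = trans (Σ<-truncate _ j≤n (λ m j<m → trans (*-congˡ (^S-vanishes u₀≈0 m j j<m)) (zeroʳ _)))
                           (reflexive (≡.sym (Σ≤≡Σ< j _)))

  Σ-compsF-suc : ∀ fuel n (φ : List ℕ → Carrier) →
                 Σ[ compsF (suc fuel) (suc n) ] φ ≈
                 Σ< (suc n) (λ k → Σ[ compsF fuel (n ∸ k) ] (λ π → φ (suc k ∷ π)))
  Σ-compsF-suc fuel n φ = begin
    Σ[ concat (map firstPart (applyUpTo (λ k → k) (suc n))) ] φ
      ≈⟨ Σ-concat (map firstPart (applyUpTo (λ k → k) (suc n))) φ ⟩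
    Σ[ map firstPart (applyUpTo (λ k → k) (suc n)) ] (λ πs → Σ[ πs ] φ)
      ≡⟨ ≡.trans (Σ-map firstPart (applyUpTo (λ k → k) (suc n)) (λ πs → Σ[ πs ] φ))
                 (Σ-applyUpTo (suc n) (λ k → k) (λ k → Σ[ firstPart k ] φ)) ⟩
    Σ< (suc n) (λ k → Σ[ firstPart k ] φ)
      ≈⟨ Σ<-cong (suc n) (λ k _ → reflexive (Σ-map (suc k ∷_) (compsF fuel (n ∸ k)) φ)) ⟩
    Σ< (suc n) (λ k → Σ[ compsF fuel (n ∸ k) ] (λ π → φ (suc k ∷ π))) ∎
    where
    firstPart : ℕ → List (List ℕ)
    firstPart k = map (suc k ∷_) (compsF fuel (suc n ∸ suc k))

  Σ-compsF-fuel : ∀ fuel fuel′ n (φ : List ℕ → Carrier) → n ≤ fuel → n ≤ fuel′ →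
                  Σ[ compsF fuel n ] φ ≈ Σ[ compsF fuel′ n ] φ
  Σ-compsF-fuel _ _ zero φ _ _ = refl
  Σ-compsF-fuel (suc fuel) (suc fuel′) (suc n) φ (s≤s n≤fuel) (s≤s n≤fuel′) =
    trans (Σ-compsF-suc fuel n φ)
          (trans (Σ<-cong (suc n) (λ k _ → Σ-compsF-fuel fuel fuel′ (n ∸ k) _
                                            (≤-trans (m∸n≤m n k) n≤fuel) (≤-trans (m∸n≤m n k) n≤fuel′)))
                 (sym (Σ-compsF-suc fuel′ n φ)))

  Σ-compositions-suc : ∀ n (φ : List ℕ → Carrier) →
                       Σ[ compositions (suc n) ] φ ≈
                       Σ< (suc n) (λ k → Σ[ compositions (n ∸ k) ] (λ π → φ (suc k ∷ π)))
  Σ-compositions-suc n φ =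
    trans (Σ-compsF-suc n n φ)
          (Σ<-cong (suc n) (λ k _ → Σ-compsF-fuel n (n ∸ k) (n ∸ k) _ (m∸n≤m n k) ≤-refl))

  compSum : Series → Series
  compSum h n = Σ[ compositions n ] (λ π → h (nparts π))

  compSum-suc : ∀ h n → compSum h (suc n) ≈ (ones ⊛ compSum (shift h)) n
  compSum-suc h n = begin
    compSum h (suc n)                                  ≈⟨ Σ-compositions-suc n (λ π → h (nparts π)) ⟩
    Σ< (suc n) (λ k → compSum (shift h) (n ∸ k))       ≈⟨ Σ<-cong (suc n) (λ k _ → *-identityˡ _) ⟨
    Σ< (suc n) (λ k → 1# * compSum (shift h) (n ∸ k))  ≡⟨ ⊛-as-Σ< ones (compSum (shift h)) n ⟨
    (ones ⊛ compSum (shift h)) n                       ∎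

  compSum-cong : ∀ {h h′} n → (∀ m → h m ≈ h′ m) → compSum h n ≈ compSum h′ n
  compSum-cong n h≈h′ = Σ-cong (compositions n) (λ π → h≈h′ (nparts π))

  compSum-+ : ∀ h h′ n → compSum (λ m → h m + h′ m) n ≈ compSum h n + compSum h′ n
  compSum-+ h h′ n = Σ-+ (compositions n) (λ π → h (nparts π)) (λ π → h′ (nparts π))

  ∘S-z/1-z≈compSum : ∀ n h → (h ∘S z/1-z) n ≈ compSum h n
  ∘S-z/1-z≈compSum = <-rec _ step
    where
    step : ∀ n → (∀ {j} → j < n → ∀ h → (h ∘S z/1-z) j ≈ compSum h j) →
           ∀ h → (h ∘S z/1-z) n ≈ compSum h n
    step zero    _  h = +-congʳ (*-identityʳ (h 0))
    step (suc n) IH h = begin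
      (h ∘S z/1-z) (suc n)                    ≈⟨ ∘S-suc refl h n ⟩
      (ones ⊛ (shift h ∘S z/1-z)) n           ≈⟨ ⊛-cong n (λ _ _ → refl) (λ j j≤n → IH (s≤s j≤n) (shift h)) ⟩
      (ones ⊛ compSum (shift h)) n            ≈⟨ compSum-suc h n ⟨
      compSum h (suc n)                       ∎

  deriv-zero : ∀ f → deriv f 0 ≈ f 1
  deriv-zero f = trans (*-congʳ (+-identityʳ 1#)) (*-identityˡ _)

  -- (m + 2) f_{m+2} = (m + 1) f_{m+2} + f_{m+2}
  deriv-shift : ∀ f m → shift (deriv f) m ≈ deriv (shift f) m + shift (shift f) m
  deriv-shift f m = trans (distribʳ _ _ _) (trans (+-comm _ _) (+-congˡ (*-identityˡ _)))

  compSum-deriv-suc : ∀ f j → compSum (deriv f) (suc j) ≈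
                      compSum (shift f) (suc j) + (ones ⊛ compSum (deriv (shift f))) j
  compSum-deriv-suc f j = begin
    compSum (deriv f) (suc j)
      ≈⟨ compSum-suc (deriv f) j ⟩
    (ones ⊛ compSum (shift (deriv f))) j
      ≈⟨ ⊛-cong {a = ones} j (λ _ _ → refl) (λ i _ →
           trans (compSum-cong i (deriv-shift f)) (compSum-+ (deriv (shift f)) (shift (shift f)) i)) ⟩
    (ones ⊛ (λ i → compSum (deriv (shift f)) i + compSum (shift (shift f)) i)) j
      ≈⟨ ⊛-distribˡ ones (compSum (deriv (shift f))) (compSum (shift (shift f))) j ⟩
    (ones ⊛ compSum (deriv (shift f))) j + (ones ⊛ compSum (shift (shift f))) j
      ≈⟨ +-comm _ _ ⟩
    (ones ⊛ compSum (shift (shift f))) j + (ones ⊛ compSum (deriv (shift f))) j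
      ≈⟨ +-congʳ (compSum-suc (shift f) j) ⟨
    compSum (shift f) (suc j) + (ones ⊛ compSum (deriv (shift f))) j ∎

  module _ (g : Series) where

    markedCompSum : Series → Series
    markedCompSum h n = Σ[ compositions n ] (λ π → h (nparts π) * Σ[ π ] g)

    markedCompSum≈rhs : ∀ f n → markedCompSum f n ≈ rhs f g n
    markedCompSum≈rhs f zero    = trans (+-identityʳ _) (zeroʳ _)
    markedCompSum≈rhs f (suc n) = refl

    -- The first part k + 1 of a composition contributes g_{k+1} when it is the marked part.
    markedCompSum-suc : ∀ h n → markedCompSum h (suc n) ≈
                        (shift g ⊛ compSum (shift h)) n + (ones ⊛ markedCompSum (shift h)) n
    markedCompSum-suc h n = begin
      markedCompSum h (suc n)
        ≈⟨ Σ-compositions-suc n (λ π → h (nparts π) * Σ[ π ] g) ⟩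
      Σ< (suc n) (λ k → Σ[ compositions (n ∸ k) ] (λ π → h (suc (nparts π)) * (g (suc k) + Σ[ π ] g)))
        ≈⟨ Σ<-cong (suc n) (λ k _ → split-first (g (suc k)) (compositions (n ∸ k))) ⟩
      Σ< (suc n) (λ k → g (suc k) * compSum (shift h) (n ∸ k) + 1# * markedCompSum (shift h) (n ∸ k))
        ≈⟨ Σ<-+ (suc n) (λ k → g (suc k) * compSum (shift h) (n ∸ k)) (λ k → 1# * markedCompSum (shift h) (n ∸ k)) ⟩
      Σ< (suc n) (λ k → g (suc k) * compSum (shift h) (n ∸ k)) + Σ< (suc n) (λ k → 1# * markedCompSum (shift h) (n ∸ k))
        ≡⟨ ≡.cong₂ _+_ (⊛-as-Σ< (shift g) (compSum (shift h)) n) (⊛-as-Σ< ones (markedCompSum (shift h)) n) ⟨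
      (shift g ⊛ compSum (shift h)) n + (ones ⊛ markedCompSum (shift h)) n ∎
      where
      split-first : ∀ x πs → Σ[ πs ] (λ π → h (suc (nparts π)) * (x + Σ[ π ] g)) ≈
                    x * Σ[ πs ] (λ π → h (suc (nparts π))) + 1# * Σ[ πs ] (λ π → h (suc (nparts π)) * Σ[ π ] g)
      split-first x πs = begin
        Σ[ πs ] (λ π → h (suc (nparts π)) * (x + Σ[ π ] g))
          ≈⟨ Σ-cong πs (λ π → trans (distribˡ _ _ _) (+-congʳ (*-comm _ _))) ⟩
        Σ[ πs ] (λ π → x * h (suc (nparts π)) + h (suc (nparts π)) * Σ[ π ] g)
          ≈⟨ Σ-+ πs _ _ ⟩
        Σ[ πs ] (λ π → x * h (suc (nparts π))) + Σ[ πs ] (λ π → h (suc (nparts π)) * Σ[ π ] g)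
          ≈⟨ +-cong (sym (*-distribˡ-Σ πs x _)) (sym (*-identityˡ _)) ⟩
        x * Σ[ πs ] (λ π → h (suc (nparts π))) + 1# * Σ[ πs ] (λ π → h (suc (nparts π)) * Σ[ π ] g) ∎

    markedCompSum≈compSum-deriv-⊛ : g 0 ≈ 0# → ∀ n f → markedCompSum f n ≈ (compSum (deriv f) ⊛ g) n
    markedCompSum≈compSum-deriv-⊛ g₀≈0 = <-rec _ step
      where
      step : ∀ n → (∀ {j} → j < n → ∀ f → markedCompSum f j ≈ (compSum (deriv f) ⊛ g) j) →
             ∀ f → markedCompSum f n ≈ (compSum (deriv f) ⊛ g) n
      step zero    _  f = +-congʳ (trans (zeroʳ _) (sym (trans (*-congˡ g₀≈0) (zeroʳ _))))
      step (suc n) IH f = begin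
        markedCompSum f (suc n)
          ≈⟨ markedCompSum-suc f n ⟩
        (shift g ⊛ compSum (shift f)) n + (ones ⊛ markedCompSum (shift f)) n
          ≈⟨ +-cong (trans (⊛-shiftˡ g (compSum (shift f)) n g₀≈0) (⊛-comm g _ (suc n)))
                    (⊛-cong n (λ _ _ → refl) (λ j j≤n → IH (s≤s j≤n) (shift f))) ⟩
        (compSum (shift f) ⊛ g) (suc n) + (ones ⊛ (compSum (deriv (shift f)) ⊛ g)) n
          ≈⟨ +-congˡ (⊛-assoc ones _ g n) ⟩
        (compSum (shift f) ⊛ g) (suc n) + ((ones ⊛ compSum (deriv (shift f))) ⊛ g) n
          ≈⟨ ⊛-split-suc (compSum (deriv f)) (compSum (shift f)) (ones ⊛ compSum (deriv (shift f))) g n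
                         (+-congʳ (deriv-zero f)) (λ j _ → compSum-deriv-suc f j) ⟨
        (compSum (deriv f) ⊛ g) (suc n) ∎

theorem13 : ∀ {c ℓ} (R : CommutativeRing c ℓ) →
    (f g : ℕ → CommutativeRing.Carrier R) →
    CommutativeRing._≈_ R (g 0) (CommutativeRing.0# R) →
    ∀ n → CommutativeRing._≈_ R (FPS.lhs R f g n) (FPS.rhs R f g n)
theorem13 R f g g₀≈0 n =
  trans (⊛-cong R {b = g} {b′ = g} n (λ i _ → ∘S-z/1-z≈compSum R i (FPS.deriv R f)) (λ _ _ → refl))
        (trans (sym (markedCompSum≈compSum-deriv-⊛ R g g₀≈0 n f)) (markedCompSum≈rhs R g f n))
  where open CommutativeRing R using (refl; trans; sym)
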